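{- For an integer $k\geq 0$, define integers $a_{k,m}(n)$ ($n\ge 0$, $m\in\mathbb{Z}$) by $$\frac{1}{(qz;q)_k\,(q/z;q)_k}=\sum_{n=0}^\infty \sum_{m=-\infty}^\infty a_{k,m}(n)z^mq^n,$$ where $(a;q)_k=\prod_{i=0}^{k-1}(1-aq^i)$ and each factor $\frac{1}{1-zq^i}$, $\frac{1}{1-q^i/z}$ is expanded as a geometric series. Then for all integers $m\geq 0$ and $n\ge 0$, $a_{k,m}(n)\geq a_{k,m+2}(n)$. Equivalently, for $m\geq 0$, the coefficient of $z^mq^n$ in $\frac{1-z^{ -2}}{(qz;q)_k(q/z;q)_k}$ is nonnegative. -}

module Defs where

open import Data.Nat as ℕ using (ℕ; zero; suc)
open import Data.Nat.DivMod using (_%_; _/_)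
open import Data.Integer as ℤ using (ℤ; +_; -_; _-_)
open import Data.List using (List; map; upTo; foldr; concatMap)
open import Relation.Nullary using (yes; no)

-- A formal series  Σ_{n ≥ 0} Σ_{m ∈ ℤ} c(n,m) z^m q^n  with integer coefficients,
-- represented by its coefficient function:  c n m = coefficient of z^m q^n.
Series : Set
Series = ℕ → ℤ → ℤ

one : Series
one zero (+ zero) = + 1
one _    _        = + 0

-- geometric expansion of 1/(1 - z^s q^j) = Σ_{t ≥ 0} z^(s t) q^(j t),
-- for j = suc i ≥ 1 and s ∈ ℤ (we use s = 1 and s = -1).
geo : ℕ → ℤ → Series
geo i s n m with n % suc i ℕ.≟ 0
... | no  _ = + 0
... | yes _ with m ℤ.≟ s ℤ.* (+ (n / suc i))
...   | yes _ = + 1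
...   | no  _ = + 0

range : ℕ → List ℤ
range r = map (λ i → + i - + r) (upTo (suc (r ℕ.+ r)))

-- All series considered here (1, the geometric
-- factors, and their products) have coefficient of z^m q^n equal to 0
-- unless |m| ≤ n, so the inner sum over m₁ ∈ ℤ reduces to |m₁| ≤ n₁.
_⊛_ : Series → Series → Series
(f ⊛ g) n m =
  foldr ℤ._+_ (+ 0) (concatMap (λ n₁ → map (λ m₁ → f n₁ m₁ ℤ.* g (n ℕ.∸ n₁) (m - m₁)) (range n₁))
                 (upTo (suc n)))

-- 1 / ((qz;q)_k (q/z;q)_k) = Π_{j=1}^{k} 1/((1 - z q^j)(1 - z⁻¹ q^j))
F : ℕ → Series
F zero    = one
F (suc k) = F k ⊛ (geo k (+ 1) ⊛ geo k (- (+ 1)))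

a : ℕ → ℤ → ℕ → ℤ
a k m n = F k n m

-- Put j = k + 1.  Then F (k + 1) = F k · Q with
--   Q = 1 / ((1 - z q^j)(1 - z⁻¹ q^j)) = Σ_T q^(jT) (z^T + z^(T-2) + ⋯ + z^(-T)),
-- so every coefficient of F (k + 1) is a sum of coefficient functions of F k multiplied
-- by the Laurent polynomials z^T + z^(T-2) + ⋯ + z^(-T).  Multiplication by such a
-- polynomial preserves symmetry under z ↦ z⁻¹ and the inequalities g(p + 2) ≤ g(p) for
-- p ≥ 0: the difference of the coefficients of z^(p+2) and z^p telescopes to
-- g(p + 2 + T) - g(p - T), and |p - T| < p + 2 + T have the same parity.  The coefficient of q^n is supported on |m| ≤ n, which is
-- what makes the truncated inner sums of the Cauchy product ⊛ exact.
module Submission where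

open import Defs
open import Data.Nat using (ℕ)
open import Data.Integer using (+_; _+_; _≤_)
open import Data.Nat as ℕ using (zero; suc; z≤n; s≤s; _∸_; NonZero)
import Data.Nat.Properties as ℕP
open import Data.Nat.DivMod
open import Data.Nat.Divisibility using (divides-refl)
import Data.Nat.Tactic.RingSolver as ℕ-Solver
open import Data.Integer as ℤ using (ℤ; -_; _-_; _*_; -[1+_]; ∣_∣)
import Data.Integer.Properties as ℤP
open import Data.Integer.Tactic.RingSolver using (solve-∀)
open import Algebra.Properties.CommutativeSemigroup ℤP.+-commutativeSemigroup using (interchange)
open import Data.List using (List; []; _∷_; _++_; map; foldr; concatMap; applyUpTo)
open import Data.List.Properties using (map-applyUpTo)
open import Data.Product using (∃; _×_; _,_)
open import Data.Sum using (_⊎_; inj₁; inj₂)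
open import Data.Empty using (⊥-elim)
open import Function using (_∘_; id)
open import Relation.Nullary using (yes; no)
open import Relation.Binary.PropositionalEquality

sumℤ : List ℤ → ℤ
sumℤ = foldr _+_ (+ 0)

∑ : ℕ → (ℕ → ℤ) → ℤ
∑ N f = sumℤ (applyUpTo f N)

infix 6.5 ∑
syntax ∑ N (λ i → e) = ∑[ i < N ] e

∑-cong : ∀ N {f g : ℕ → ℤ} → (∀ i → i ℕ.< N → f i ≡ g i) → ∑ N f ≡ ∑ N g
∑-cong zero    eq = refl
∑-cong (suc N) eq = cong₂ _+_ (eq 0 (s≤s z≤n)) (∑-cong N (λ i i<N → eq (suc i) (s≤s i<N)))

∑-zero : ∀ N {f : ℕ → ℤ} → (∀ i → i ℕ.< N → f i ≡ + 0) → ∑ N f ≡ + 0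
∑-zero zero    eq = refl
∑-zero (suc N) eq = cong₂ _+_ (eq 0 (s≤s z≤n)) (∑-zero N (λ i i<N → eq (suc i) (s≤s i<N)))

∑-mono-≤ : ∀ N {f g : ℕ → ℤ} → (∀ i → i ℕ.< N → f i ≤ g i) → ∑ N f ≤ ∑ N g
∑-mono-≤ zero    le = ℤP.≤-refl
∑-mono-≤ (suc N) le = ℤP.+-mono-≤ (le 0 (s≤s z≤n)) (∑-mono-≤ N (λ i i<N → le (suc i) (s≤s i<N)))

∑-distrib-+ : ∀ N (f g : ℕ → ℤ) → ∑[ i < N ] (f i + g i) ≡ ∑ N f + ∑ N g
∑-distrib-+ zero    f g = refl
∑-distrib-+ (suc N) f g = trans (cong (_+_ (f 0 + g 0)) (∑-distrib-+ N (f ∘ suc) (g ∘ suc)))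
                                (interchange (f 0) (g 0) _ _)

*-distribˡ-∑ : ∀ N c (f : ℕ → ℤ) → c * ∑ N f ≡ ∑[ i < N ] c * f i
*-distribˡ-∑ zero    c f = ℤP.*-zeroʳ c
*-distribˡ-∑ (suc N) c f = trans (ℤP.*-distribˡ-+ c (f 0) _)
                                 (cong (_+_ (c * f 0)) (*-distribˡ-∑ N c (f ∘ suc)))

∑-comm : ∀ A B (f : ℕ → ℕ → ℤ) → ∑[ i < A ] ∑ B (f i) ≡ ∑[ t < B ] ∑[ i < A ] f i t
∑-comm zero    B f = sym (∑-zero B (λ _ _ → refl))
∑-comm (suc A) B f = trans (cong (_+_ (∑ B (f 0))) (∑-comm A B (f ∘ suc)))
                           (sym (∑-distrib-+ B (f 0) _))

∑-init-last : ∀ N (f : ℕ → ℤ) → ∑ (suc N) f ≡ ∑ N f + f N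
∑-init-last zero    f = trans (ℤP.+-identityʳ (f 0)) (sym (ℤP.+-identityˡ (f 0)))
∑-init-last (suc N) f = trans (cong (_+_ (f 0)) (∑-init-last N (f ∘ suc)))
                              (sym (ℤP.+-assoc (f 0) _ _))

∑-reverse : ∀ T (f : ℕ → ℤ) → ∑ (suc T) f ≡ ∑[ t < suc T ] f (T ∸ t)
∑-reverse zero    f = refl
∑-reverse (suc T) f = begin
  f 0 + ∑ (suc T) (f ∘ suc)                        ≡⟨ cong (_+_ (f 0)) (∑-reverse T (f ∘ suc)) ⟩
  f 0 + ∑[ t < suc T ] f (suc (T ∸ t))             ≡⟨ cong (_+_ (f 0)) (∑-cong (suc T) suc-∸) ⟩
  f 0 + ∑[ t < suc T ] f (suc T ∸ t)               ≡⟨ ℤP.+-comm (f 0) _ ⟩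
  ∑[ t < suc T ] f (suc T ∸ t) + f 0               ≡⟨ cong (λ z → ∑[ t < suc T ] f (suc T ∸ t) + f z)
                                                           (sym (ℕP.n∸n≡0 T)) ⟩
  ∑[ t < suc T ] f (suc T ∸ t) + f (suc T ∸ suc T) ≡⟨ sym (∑-init-last (suc T) (λ t → f (suc T ∸ t))) ⟩
  ∑[ t < suc (suc T) ] f (suc T ∸ t)               ∎
  where
  open ≡-Reasoning
  suc-∸ : ∀ t → t ℕ.< suc T → f (suc (T ∸ t)) ≡ f (suc T ∸ t)
  suc-∸ t t≤T = cong f (sym (ℕP.+-∸-assoc 1 (ℕP.≤-pred t≤T)))

suc-/-cases : ∀ N j .{{_ : NonZero j}} →
              (suc N % j ≢ 0 × suc N / j ≡ N / j) ⊎ suc N ≡ suc (N / j) ℕ.* j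
suc-/-cases N j with suc (N % j) ℕ.≟ j
... | yes 1+r≡j = inj₂ (trans (cong suc (m≡m%n+[m/n]*n N j)) (cong (ℕ._+ N / j ℕ.* j) 1+r≡j))
... | no  1+r≢j = inj₁ (1+N%j≢0 , 1+N/j≡N/j)
  where
  open ≡-Reasoning
  1+r<j : suc (N % j) ℕ.< j
  1+r<j = ℕP.≤∧≢⇒< (m%n<n N j) 1+r≢j
  1+N≡ : suc N ≡ suc (N % j) ℕ.+ N / j ℕ.* j
  1+N≡ = cong suc (m≡m%n+[m/n]*n N j)
  1+N%j≢0 : suc N % j ≢ 0
  1+N%j≢0 eq = ℕP.1+n≢0 (begin
    suc (N % j)                         ≡⟨ sym (m<n⇒m%n≡m 1+r<j) ⟩
    suc (N % j) % j                     ≡⟨ sym ([m+kn]%n≡m%n (suc (N % j)) (N / j) j) ⟩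
    (suc (N % j) ℕ.+ N / j ℕ.* j) % j   ≡⟨ cong (_% j) (sym 1+N≡) ⟩
    suc N % j                           ≡⟨ eq ⟩
    0                                   ∎)
  1+N/j≡N/j : suc N / j ≡ N / j
  1+N/j≡N/j = begin
    suc N / j                           ≡⟨ /-congˡ 1+N≡ ⟩
    (suc (N % j) ℕ.+ N / j ℕ.* j) / j   ≡⟨ +-distrib-/-∣ʳ (suc (N % j)) (divides-refl (N / j)) ⟩
    suc (N % j) / j ℕ.+ N / j ℕ.* j / j ≡⟨ cong₂ ℕ._+_ (m<n⇒m/n≡0 1+r<j) (m*n/n≡m (N / j) j) ⟩
    N / j                               ∎

∑-multiples : ∀ j .{{_ : NonZero j}} N (h : ℕ → ℤ) → (∀ n → n % j ≢ 0 → h n ≡ + 0) →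
              ∑ (suc N) h ≡ ∑[ t < suc (N / j) ] h (t ℕ.* j)
∑-multiples j zero    h h∤ = cong (λ q → ∑[ t < suc q ] h (t ℕ.* j)) (sym (0/n≡0 j))
∑-multiples j (suc N) h h∤ = begin
  ∑ (suc (suc N)) h             ≡⟨ ∑-init-last (suc N) h ⟩
  ∑ (suc N) h + h (suc N)       ≡⟨ cong (_+ h (suc N)) (∑-multiples j N h h∤) ⟩
  ∑ (suc (N / j)) H + h (suc N) ≡⟨ add-last (suc-/-cases N j) ⟩
  ∑ (suc (suc N / j)) H         ∎
  where
  open ≡-Reasoning
  H : ℕ → ℤ
  H t = h (t ℕ.* j)
  add-last : (suc N % j ≢ 0 × suc N / j ≡ N / j) ⊎ suc N ≡ suc (N / j) ℕ.* j →
             ∑ (suc (N / j)) H + h (suc N) ≡ ∑ (suc (suc N / j)) H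
  add-last (inj₁ (∤ , 1+N/j≡N/j)) = begin
    ∑ (suc (N / j)) H + h (suc N)       ≡⟨ cong (_+_ (∑ (suc (N / j)) H)) (h∤ (suc N) ∤) ⟩
    ∑ (suc (N / j)) H + + 0             ≡⟨ ℤP.+-identityʳ _ ⟩
    ∑ (suc (N / j)) H                   ≡⟨ cong (λ q → ∑ (suc q) H) (sym 1+N/j≡N/j) ⟩
    ∑ (suc (suc N / j)) H               ∎
  add-last (inj₂ 1+N≡) = begin
    ∑ (suc (N / j)) H + h (suc N)       ≡⟨ cong (_+_ (∑ (suc (N / j)) H)) (cong h 1+N≡) ⟩
    ∑ (suc (N / j)) H + H (suc (N / j)) ≡⟨ sym (∑-init-last (suc (N / j)) H) ⟩
    ∑ (suc (suc (N / j))) H             ≡⟨ cong (λ q → ∑ (suc q) H) (sym 1+N/j≡) ⟩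
    ∑ (suc (suc N / j)) H               ∎
    where
    1+N/j≡ : suc N / j ≡ suc (N / j)
    1+N/j≡ = trans (/-congˡ 1+N≡) (m*n/n≡m (suc (N / j)) j)

sumℤ-++ : ∀ xs ys → sumℤ (xs ++ ys) ≡ sumℤ xs + sumℤ ys
sumℤ-++ []       ys = sym (ℤP.+-identityˡ (sumℤ ys))
sumℤ-++ (x ∷ xs) ys = trans (cong (_+_ x) (sumℤ-++ xs ys)) (sym (ℤP.+-assoc x (sumℤ xs) (sumℤ ys)))

sumℤ-concatMap : ∀ (H : ℕ → List ℤ) (u : ℕ → ℕ) N →
                 sumℤ (concatMap H (applyUpTo u N)) ≡ ∑[ i < N ] sumℤ (H (u i))
sumℤ-concatMap H u zero    = refl
sumℤ-concatMap H u (suc N) = trans (sumℤ-++ (H (u 0)) _)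
                                   (cong (_+_ (sumℤ (H (u 0)))) (sumℤ-concatMap H (u ∘ suc) N))

∑± : ℕ → (ℤ → ℤ) → ℤ
∑± r h = ∑[ i < suc (r ℕ.+ r) ] h (+ i - + r)

sumℤ-range : ∀ (h : ℤ → ℤ) r → sumℤ (map h (range r)) ≡ ∑± r h
sumℤ-range h r = cong sumℤ (trans (cong (map h) (map-applyUpTo id shift N)) (map-applyUpTo shift h N))
  where
  N = suc (r ℕ.+ r)
  shift : ℕ → ℤ
  shift i = + i - + r

⊛-as-∑ : ∀ f g n m → (f ⊛ g) n m ≡ ∑[ n₁ < suc n ] ∑± n₁ (λ x → f n₁ x * g (n ∸ n₁) (m - x))
⊛-as-∑ f g n m = trans (sumℤ-concatMap (λ n₁ → map (term n₁) (range n₁)) id (suc n))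
                       (∑-cong (suc n) (λ n₁ _ → sumℤ-range (term n₁) n₁))
  where
  term : ℕ → ℤ → ℤ
  term n₁ x = f n₁ x * g (n ∸ n₁) (m - x)

δ : ℤ → ℤ → ℤ
δ a b with a ℤ.≟ b
... | yes _ = + 1
... | no  _ = + 0

δ-refl : ∀ a → δ a a ≡ + 1
δ-refl a with a ℤ.≟ a
... | yes _   = refl
... | no  a≢a = ⊥-elim (a≢a refl)

δ-≢ : ∀ {a b} → a ≢ b → δ a b ≡ + 0
δ-≢ {a} {b} a≢b with a ℤ.≟ b
... | yes a≡b = ⊥-elim (a≢b a≡b)
... | no  _   = refl

δ-sym : ∀ a b → δ a b ≡ δ b a
δ-sym a b with a ℤ.≟ b | b ℤ.≟ a
... | yes _   | yes _   = refl
... | no  _   | no  _   = refl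
... | yes a≡b | no  b≢a = ⊥-elim (b≢a (sym a≡b))
... | no  a≢b | yes b≡a = ⊥-elim (a≢b (sym b≡a))

δ-resp-diff : ∀ a b c d → a - b ≡ c - d → δ a b ≡ δ c d
δ-resp-diff a b c d eq with a ℤ.≟ b | c ℤ.≟ d
... | yes _   | yes _   = refl
... | no  _   | no  _   = refl
... | yes a≡b | no  c≢d = ⊥-elim (c≢d (ℤP.i-j≡0⇒i≡j c d (trans (sym eq) (ℤP.i≡j⇒i-j≡0 a≡b))))
... | no  a≢b | yes c≡d = ⊥-elim (a≢b (ℤP.i-j≡0⇒i≡j a b (trans eq (ℤP.i≡j⇒i-j≡0 c≡d))))

δ-*-subst : ∀ x w (Y : ℤ → ℤ) → δ x w * Y x ≡ δ x w * Y w
δ-*-subst x w Y with x ℤ.≟ w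
... | yes refl = refl
... | no  _    = refl

∑-δ : ∀ N i₀ (X : ℕ → ℤ) → i₀ ℕ.< N → ∑[ i < N ] δ (+ i) (+ i₀) * X i ≡ X i₀
∑-δ (suc N) zero X _ = begin
  δ (+ 0) (+ 0) * X 0 + ∑[ i < N ] δ (+ suc i) (+ 0) * X (suc i) ≡⟨ cong₂ _+_ head rest ⟩
  X 0 + + 0                                                      ≡⟨ ℤP.+-identityʳ (X 0) ⟩
  X 0                                                            ∎
  where
  open ≡-Reasoning
  head : δ (+ 0) (+ 0) * X 0 ≡ X 0
  head = trans (cong (_* X 0) (δ-refl (+ 0))) (ℤP.*-identityˡ (X 0))
  rest : ∑[ i < N ] δ (+ suc i) (+ 0) * X (suc i) ≡ + 0
  rest = ∑-zero N (λ i _ → trans (cong (_* X (suc i)) (δ-≢ {+ suc i} {+ 0} λ ())) (ℤP.*-zeroˡ (X (suc i))))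
∑-δ (suc N) (suc i₀) X (s≤s i₀<N) = begin
  δ (+ 0) (+ suc i₀) * X 0 + ∑[ i < N ] δ (+ suc i) (+ suc i₀) * X (suc i) ≡⟨ cong₂ _+_ head rest ⟩
  + 0 + ∑[ i < N ] δ (+ i) (+ i₀) * X (suc i)                             ≡⟨ ℤP.+-identityˡ _ ⟩
  ∑[ i < N ] δ (+ i) (+ i₀) * X (suc i)                                   ≡⟨ ∑-δ N i₀ (X ∘ suc) i₀<N ⟩
  X (suc i₀)                                                              ∎
  where
  open ≡-Reasoning
  1+i-1+j : ∀ i j → (+ 1 + i) - (+ 1 + j) ≡ i - j
  1+i-1+j = solve-∀
  head : δ (+ 0) (+ suc i₀) * X 0 ≡ + 0
  head = trans (cong (_* X 0) (δ-≢ {+ 0} {+ suc i₀} λ ())) (ℤP.*-zeroˡ (X 0))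
  rest : ∑[ i < N ] δ (+ suc i) (+ suc i₀) * X (suc i) ≡ ∑[ i < N ] δ (+ i) (+ i₀) * X (suc i)
  rest = ∑-cong N (λ i _ → cong (_* X (suc i))
                                (δ-resp-diff (+ suc i) (+ suc i₀) (+ i) (+ i₀) (1+i-1+j (+ i) (+ i₀))))

∑±-δ : ∀ r {w} (Y : ℤ → ℤ) i₀ → w + + r ≡ + i₀ → i₀ ℕ.< suc (r ℕ.+ r) →
       ∑± r (λ x → δ x w * Y x) ≡ Y w
∑±-δ r {w} Y i₀ w+r≡i₀ i₀<N = begin
  ∑± r (λ x → δ x w * Y x)
    ≡⟨ ∑-cong (suc (r ℕ.+ r)) recentre ⟩
  ∑[ i < suc (r ℕ.+ r) ] δ (+ i) (+ i₀) * Y (+ i - + r)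
    ≡⟨ ∑-δ (suc (r ℕ.+ r)) i₀ (λ i → Y (+ i - + r)) i₀<N ⟩
  Y (+ i₀ - + r)
    ≡⟨ cong Y (trans (cong (_- + r) (sym w+r≡i₀)) (cancel w (+ r))) ⟩
  Y w ∎
  where
  open ≡-Reasoning
  reassoc : ∀ i r w → (i - r) - w ≡ i - (w + r)
  reassoc = solve-∀
  cancel : ∀ x y → (x + y) - y ≡ x
  cancel = solve-∀
  recentre : ∀ i → i ℕ.< suc (r ℕ.+ r) → δ (+ i - + r) w * Y (+ i - + r) ≡ δ (+ i) (+ i₀) * Y (+ i - + r)
  recentre i _ = cong (_* Y (+ i - + r)) (δ-resp-diff (+ i - + r) w (+ i) (+ i₀)
                                            (trans (reassoc (+ i) (+ r) w) (cong (_-_ (+ i)) w+r≡i₀)))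

∣w∣≤r⇒w+r≡+ : ∀ {r} w → ∣ w ∣ ℕ.≤ r → ∃ λ i₀ → w + + r ≡ + i₀ × i₀ ℕ.< suc (r ℕ.+ r)
∣w∣≤r⇒w+r≡+ {r} (+ p)    p≤r   = p ℕ.+ r , refl , s≤s (ℕP.+-monoˡ-≤ r p≤r)
∣w∣≤r⇒w+r≡+ {r} -[1+ p ] 1+p≤r =
  r ∸ suc p , ℤP.⊖-≥ 1+p≤r , s≤s (ℕP.≤-trans (ℕP.m∸n≤m r (suc p)) (ℕP.m≤m+n r r))

Supported : ℕ → (ℤ → ℤ) → Set
Supported r g = ∀ x → r ℕ.< ∣ x ∣ → g x ≡ + 0

∑±-δ-supported : ∀ {r} {Y : ℤ → ℤ} → Supported r Y → ∀ w → ∑± r (λ x → δ x w * Y x) ≡ Y w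
∑±-δ-supported {r} {Y} supp w with ∣ w ∣ ℕ.≤? r
... | yes ∣w∣≤r = let (i₀ , w+r≡i₀ , i₀<N) = ∣w∣≤r⇒w+r≡+ w ∣w∣≤r in ∑±-δ r Y i₀ w+r≡i₀ i₀<N
... | no  ∣w∣≰r = trans (∑-zero (suc (r ℕ.+ r)) (λ i _ → vanishes (+ i - + r))) (sym Yw≡0)
  where
  open ≡-Reasoning
  Yw≡0 : Y w ≡ + 0
  Yw≡0 = supp w (ℕP.≰⇒> ∣w∣≰r)
  vanishes : ∀ x → δ x w * Y x ≡ + 0
  vanishes x = begin
    δ x w * Y x   ≡⟨ δ-*-subst x w Y ⟩
    δ x w * Y w   ≡⟨ cong (δ x w *_) Yw≡0 ⟩
    δ x w * + 0   ≡⟨ ℤP.*-zeroʳ (δ x w) ⟩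
    + 0           ∎

-- atMultiple k n K is the coefficient of q^n in Σ_T K T · q^((k+1) T).
atMultiple : ℕ → ℕ → (ℕ → ℤ) → ℤ
atMultiple k n K with n % suc k ℕ.≟ 0
... | yes _ = K (n / suc k)
... | no  _ = + 0

atMultiple-∣ : ∀ k n K → n % suc k ≡ 0 → atMultiple k n K ≡ K (n / suc k)
atMultiple-∣ k n K ∣ with n % suc k ℕ.≟ 0
... | yes _ = refl
... | no  ∤ = ⊥-elim (∤ ∣)

atMultiple-∤ : ∀ k n K → n % suc k ≢ 0 → atMultiple k n K ≡ + 0
atMultiple-∤ k n K ∤ with n % suc k ℕ.≟ 0
... | yes ∣ = ⊥-elim (∤ ∣)
... | no  _ = refl

atMultiple-cases : ∀ k n (K : ℕ → ℤ) {x} →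
                   (n % suc k ≡ 0 → x ≡ K (n / suc k)) → (n % suc k ≢ 0 → x ≡ + 0) →
                   x ≡ atMultiple k n K
atMultiple-cases k n K ∣-case ∤-case with n % suc k ℕ.≟ 0
... | yes ∣ = ∣-case ∣
... | no  ∤ = ∤-case ∤

atMultiple-* : ∀ k t K → atMultiple k (t ℕ.* suc k) K ≡ K t
atMultiple-* k t K = trans (atMultiple-∣ k (t ℕ.* suc k) K (m*n%n≡0 t (suc k)))
                           (cong K (m*n/n≡m t (suc k)))

atMultiple-cong : ∀ k n {K K′ : ℕ → ℤ} → (∀ T → T ℕ.≤ n → K T ≡ K′ T) →
                  atMultiple k n K ≡ atMultiple k n K′
atMultiple-cong k n eq with n % suc k ℕ.≟ 0
... | yes _ = eq _ (m/n≤m n (suc k))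
... | no  _ = refl

atMultiple-zero : ∀ k n {K : ℕ → ℤ} → (∀ T → T ℕ.≤ n → K T ≡ + 0) → atMultiple k n K ≡ + 0
atMultiple-zero k n eq with n % suc k ℕ.≟ 0
... | yes _ = eq _ (m/n≤m n (suc k))
... | no  _ = refl

atMultiple-mono-≤ : ∀ k n {K K′ : ℕ → ℤ} → (∀ T → K T ≤ K′ T) → atMultiple k n K ≤ atMultiple k n K′
atMultiple-mono-≤ k n le with n % suc k ℕ.≟ 0
... | yes _ = le _
... | no  _ = ℤP.≤-refl

atMultiple-map : ∀ k n (φ : ℤ → ℤ) (K : ℕ → ℤ) → φ (+ 0) ≡ + 0 →
                 φ (atMultiple k n K) ≡ atMultiple k n (φ ∘ K)
atMultiple-map k n φ K φ0≡0 with n % suc k ℕ.≟ 0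
... | yes _ = refl
... | no  _ = φ0≡0

∑-atMultiple : ∀ k n N (K : ℕ → ℕ → ℤ) →
               ∑[ i < N ] atMultiple k n (K i) ≡ atMultiple k n (λ T → ∑[ i < N ] K i T)
∑-atMultiple k n N K with n % suc k ℕ.≟ 0
... | yes _ = refl
... | no  _ = ∑-zero N (λ _ _ → refl)

geo-atMultiple : ∀ k s n m → geo k s n m ≡ atMultiple k n (λ T → δ m (s * + T))
geo-atMultiple k s n m with n % suc k ℕ.≟ 0
... | no  _ = refl
... | yes _ with m ℤ.≟ s * + (n / suc k)
...   | yes _ = refl
...   | no  _ = refl

Q : ℕ → Series
Q k = geo k (+ 1) ⊛ geo k (- (+ 1))

∑±-geo⁺ : ∀ k r (Y : ℤ → ℤ) → ∑± r (λ x → geo k (+ 1) r x * Y x) ≡ atMultiple k r (λ s → Y (+ s))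
∑±-geo⁺ k r Y = begin
  ∑± r (λ x → geo k (+ 1) r x * Y x)
    ≡⟨ ∑-cong N (λ i _ → expand (x i)) ⟩
  ∑[ i < N ] atMultiple k r (λ s → δ (x i) (+ 1 * + s) * Y (x i))
    ≡⟨ ∑-atMultiple k r N (λ i s → δ (x i) (+ 1 * + s) * Y (x i)) ⟩
  atMultiple k r (λ s → ∑± r (λ x → δ x (+ 1 * + s) * Y x))
    ≡⟨ atMultiple-cong k r sift ⟩
  atMultiple k r (λ s → Y (+ s)) ∎
  where
  open ≡-Reasoning
  N = suc (r ℕ.+ r)
  x : ℕ → ℤ
  x i = + i - + r
  expand : ∀ y → geo k (+ 1) r y * Y y ≡ atMultiple k r (λ s → δ y (+ 1 * + s) * Y y)
  expand y = trans (cong (_* Y y) (geo-atMultiple k (+ 1) r y)) (atMultiple-map k r (_* Y y) _ (ℤP.*-zeroˡ (Y y)))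
  sift : ∀ s → s ℕ.≤ r → ∑± r (λ x → δ x (+ 1 * + s) * Y x) ≡ Y (+ s)
  sift s s≤r = trans (∑-cong N (λ i _ → cong (λ w → δ (x i) w * Y (x i)) (ℤP.*-identityˡ (+ s))))
                     (∑±-δ r Y (s ℕ.+ r) refl (s≤s (ℕP.+-monoˡ-≤ r s≤r)))

∑-geo⁻ : ∀ k n c → ∑[ t < suc (n / suc k) ] geo k (- (+ 1)) (n ∸ t ℕ.* suc k) (c - + t)
                   ≡ atMultiple k n (λ T → ∑[ t < suc T ] δ c (+ t - + (T ∸ t)))
∑-geo⁻ k n c = atMultiple-cases k n _ (λ j∣n → ∑-cong (suc (n / j)) (multiple j∣n)) non-multiple
  where
  open ≡-Reasoning
  j = suc k
  reassoc : ∀ c t u → (c - t) - (- (+ 1) * u) ≡ c - (t - u)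
  reassoc = solve-∀
  multiple : n % j ≡ 0 → ∀ t → t ℕ.< suc (n / j) →
             geo k (- (+ 1)) (n ∸ t ℕ.* j) (c - + t) ≡ δ c (+ t - + (n / j ∸ t))
  multiple j∣n t _ = begin
    geo k (- (+ 1)) (n ∸ t ℕ.* j) (c - + t)    ≡⟨ cong (λ n → geo k (- (+ 1)) n (c - + t)) n-tj≡ ⟩
    geo k (- (+ 1)) ((T ∸ t) ℕ.* j) (c - + t)  ≡⟨ geo-atMultiple k (- (+ 1)) ((T ∸ t) ℕ.* j) (c - + t) ⟩
    atMultiple k ((T ∸ t) ℕ.* j) (λ u → δ (c - + t) (- (+ 1) * + u))
                                               ≡⟨ atMultiple-* k (T ∸ t) (λ u → δ (c - + t) (- (+ 1) * + u)) ⟩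
    δ (c - + t) (- (+ 1) * + (T ∸ t))          ≡⟨ δ-resp-diff _ _ c _ (reassoc c (+ t) (+ (T ∸ t))) ⟩
    δ c (+ t - + (T ∸ t))                      ∎
    where
    T = n / j
    n-tj≡ : n ∸ t ℕ.* j ≡ (T ∸ t) ℕ.* j
    n-tj≡ = begin
      n ∸ t ℕ.* j       ≡⟨ cong (_∸ t ℕ.* j) (trans (m≡m%n+[m/n]*n n j) (cong (ℕ._+ T ℕ.* j) j∣n)) ⟩
      T ℕ.* j ∸ t ℕ.* j ≡⟨ sym (ℕP.*-distribʳ-∸ j T t) ⟩
      (T ∸ t) ℕ.* j     ∎
  non-multiple : n % j ≢ 0 → ∑[ t < suc (n / j) ] geo k (- (+ 1)) (n ∸ t ℕ.* j) (c - + t) ≡ + 0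
  non-multiple j∤n = ∑-zero (suc (n / j)) (λ t t≤n/j → trans
    (geo-atMultiple k (- (+ 1)) (n ∸ t ℕ.* j) (c - + t))
    (atMultiple-∤ k (n ∸ t ℕ.* j) (λ T → δ (c - + t) (- (+ 1) * + T))
      (λ j∣n-tj → j∤n (trans (sym (m*n≤o⇒[o∸m*n]%n≡o%n t (tj≤n t≤n/j))) j∣n-tj))))
    where
    tj≤n : ∀ {t} → t ℕ.< suc (n / j) → t ℕ.* j ℕ.≤ n
    tj≤n t≤n/j = ℕP.≤-trans (ℕP.*-monoˡ-≤ j (ℕP.≤-pred t≤n/j)) (m/n*n≤m n j)

Q-coeff : ∀ k n c → Q k n c ≡ atMultiple k n (λ T → ∑[ t < suc T ] δ c (+ t - + (T ∸ t)))
Q-coeff k n c = begin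
  Q k n c
    ≡⟨ ⊛-as-∑ (geo k (+ 1)) (geo k (- (+ 1))) n c ⟩
  ∑[ n₁ < suc n ] ∑± n₁ (λ x → geo k (+ 1) n₁ x * geo k (- (+ 1)) (n ∸ n₁) (c - x))
    ≡⟨ ∑-cong (suc n) (λ n₁ _ → ∑±-geo⁺ k n₁ (λ x → geo k (- (+ 1)) (n ∸ n₁) (c - x))) ⟩
  ∑[ n₁ < suc n ] atMultiple k n₁ (G n₁)
    ≡⟨ ∑-multiples (suc k) n (λ n₁ → atMultiple k n₁ (G n₁)) (λ n₁ → atMultiple-∤ k n₁ (G n₁)) ⟩
  ∑[ t < suc (n / suc k) ] atMultiple k (t ℕ.* suc k) (G (t ℕ.* suc k))
    ≡⟨ ∑-cong (suc (n / suc k)) (λ t _ → atMultiple-* k t (G (t ℕ.* suc k))) ⟩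
  ∑[ t < suc (n / suc k) ] geo k (- (+ 1)) (n ∸ t ℕ.* suc k) (c - + t)
    ≡⟨ ∑-geo⁻ k n c ⟩
  atMultiple k n (λ T → ∑[ t < suc T ] δ c (+ t - + (T ∸ t))) ∎
  where
  open ≡-Reasoning
  G : ℕ → ℕ → ℤ
  G n₁ s = geo k (- (+ 1)) (n ∸ n₁) (c - + s)

-- spread T g is the coefficient function of g · (z^T + z^(T-2) + ⋯ + z^(-T)).
spread : ℕ → (ℤ → ℤ) → ℤ → ℤ
spread T g m = ∑[ t < suc T ] g (m + (+ (T ∸ t) - + t))

∑±-*Q : ∀ k n {r} {g : ℤ → ℤ} → Supported r g → ∀ m →
        ∑± r (λ x → g x * Q k n (m - x)) ≡ atMultiple k n (λ T → spread T g m)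
∑±-*Q k n {r} {g} supp m = begin
  ∑± r (λ x → g x * Q k n (m - x))
    ≡⟨ ∑-cong N (λ i _ → expand (x i)) ⟩
  ∑[ i < N ] atMultiple k n (λ T → g (x i) * C T (m - x i))
    ≡⟨ ∑-atMultiple k n N (λ i T → g (x i) * C T (m - x i)) ⟩
  atMultiple k n (λ T → ∑± r (λ x → g x * C T (m - x)))
    ≡⟨ atMultiple-cong k n (λ T _ → sift T) ⟩
  atMultiple k n (λ T → spread T g m) ∎
  where
  open ≡-Reasoning
  N = suc (r ℕ.+ r)
  x : ℕ → ℤ
  x i = + i - + r
  d : ℕ → ℕ → ℤ
  d T t = + t - + (T ∸ t)
  C : ℕ → ℤ → ℤ
  C T c = ∑[ t < suc T ] δ c (d T t)
  expand : ∀ y → g y * Q k n (m - y) ≡ atMultiple k n (λ T → g y * C T (m - y))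
  expand y = trans (cong (g y *_) (Q-coeff k n (m - y))) (atMultiple-map k n (g y *_) _ (ℤP.*-zeroʳ (g y)))
  reflect : ∀ m y e → e - (m - y) ≡ y - (m - e)
  reflect = solve-∀
  flip : ∀ y e → g y * δ (m - y) e ≡ δ y (m - e) * g y
  flip y e = trans (ℤP.*-comm (g y) (δ (m - y) e))
                   (cong (_* g y) (trans (δ-sym (m - y) e) (δ-resp-diff e (m - y) y (m - e) (reflect m y e))))
  unfold : ∀ m t u → m - (t - u) ≡ m + (u - t)
  unfold = solve-∀
  sift : ∀ T → ∑± r (λ x → g x * C T (m - x)) ≡ spread T g m
  sift T = begin
    ∑± r (λ x → g x * C T (m - x))
      ≡⟨ ∑-cong N (λ i _ → *-distribˡ-∑ (suc T) (g (x i)) (λ t → δ (m - x i) (d T t))) ⟩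
    ∑[ i < N ] ∑[ t < suc T ] g (x i) * δ (m - x i) (d T t)
      ≡⟨ ∑-comm N (suc T) (λ i t → g (x i) * δ (m - x i) (d T t)) ⟩
    ∑[ t < suc T ] ∑± r (λ y → g y * δ (m - y) (d T t))
      ≡⟨ ∑-cong (suc T) (λ t _ → ∑-cong N (λ i _ → flip (x i) (d T t))) ⟩
    ∑[ t < suc T ] ∑± r (λ y → δ y (m - d T t) * g y)
      ≡⟨ ∑-cong (suc T) (λ t _ → ∑±-δ-supported supp (m - d T t)) ⟩
    ∑[ t < suc T ] g (m - d T t)
      ≡⟨ ∑-cong (suc T) (λ t _ → cong g (unfold m (+ t) (+ (T ∸ t)))) ⟩
    spread T g m ∎

mulQ : ℕ → Series → Series
mulQ k f n m = ∑[ n₁ < suc n ] atMultiple k (n ∸ n₁) (λ T → spread T (f n₁) m)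

⊛-Q : ∀ k f → (∀ n → Supported n (f n)) → ∀ n m → (f ⊛ Q k) n m ≡ mulQ k f n m
⊛-Q k f supp n m = trans (⊛-as-∑ f (Q k) n m) (∑-cong (suc n) (λ n₁ _ → ∑±-*Q k (n ∸ n₁) (supp n₁) m))

Symmetric : (ℤ → ℤ) → Set
Symmetric g = ∀ x → g (- x) ≡ g x

NonincreasingBy2 : (ℤ → ℤ) → Set
NonincreasingBy2 g = ∀ p → g (+ p + + 2) ≤ g (+ p)

spread-supported : ∀ {r g} → Supported r g → ∀ T → Supported (r ℕ.+ T) (spread T g)
spread-supported {r} {g} supp T x r+T<∣x∣ =
  ∑-zero (suc T) (λ t t≤T → supp (x + (+ (T ∸ t) - + t)) (r<∣x+d∣ t (ℕP.≤-pred t≤T)))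
  where
  cancel : ∀ x d → (x + d) - d ≡ x
  cancel = solve-∀
  r<∣x+d∣ : ∀ t → t ℕ.≤ T → r ℕ.< ∣ x + (+ (T ∸ t) - + t) ∣
  r<∣x+d∣ t t≤T = ℕP.+-cancelʳ-< T r ∣ x + d ∣ (begin-strict
    r ℕ.+ T             <⟨ r+T<∣x∣ ⟩
    ∣ x ∣               ≡⟨ cong ∣_∣ (sym (cancel x d)) ⟩
    ∣ (x + d) - d ∣     ≤⟨ ℤP.∣i-j∣≤∣i∣+∣j∣ (x + d) d ⟩
    ∣ x + d ∣ ℕ.+ ∣ d ∣ ≤⟨ ℕP.+-monoʳ-≤ ∣ x + d ∣ ∣d∣≤T ⟩
    ∣ x + d ∣ ℕ.+ T     ∎)
    where
    open ℕP.≤-Reasoning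
    d = + (T ∸ t) - + t
    ∣d∣≤T : ∣ d ∣ ℕ.≤ T
    ∣d∣≤T = subst (∣ d ∣ ℕ.≤_) (ℕP.m∸n+n≡m t≤T) (ℤP.∣i-j∣≤∣i∣+∣j∣ (+ (T ∸ t)) (+ t))

spread-symmetric : ∀ {g} → Symmetric g → ∀ T → Symmetric (spread T g)
spread-symmetric {g} sym-g T x = begin
  spread T g (- x)
    ≡⟨ ∑-cong (suc T) (λ t _ → trans (cong g (negate x (+ (T ∸ t)) (+ t))) (sym-g _)) ⟩
  ∑[ t < suc T ] g (x + (+ t - + (T ∸ t)))
    ≡⟨ ∑-cong (suc T) (λ t t≤T → cong (λ s → g (x + (+ s - + (T ∸ t))))
                                      (sym (ℕP.m∸[m∸n]≡n (ℕP.≤-pred t≤T)))) ⟩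
  ∑[ t < suc T ] g (x + (+ (T ∸ (T ∸ t)) - + (T ∸ t)))
    ≡⟨ sym (∑-reverse T (λ t → g (x + (+ (T ∸ t) - + t)))) ⟩
  spread T g x ∎
  where
  open ≡-Reasoning
  negate : ∀ x a b → - x + (a - b) ≡ - (x + (b - a))
  negate = solve-∀

spread-head : ∀ T g x → spread T g (x + + 2) ≡ g (x + + 2 + + T) + ∑[ t < T ] g (x + (+ (T ∸ t) - + t))
spread-head T g x = cong₂ _+_ (cong g (drop-0 (x + + 2) (+ T))) (∑-cong T (λ t t<T → cong g (trans
  (shift x (+ (T ∸ suc t)) (+ t)) (cong (λ s → x + (+ s - + t)) (sym (ℕP.+-∸-assoc 1 t<T))))))
  where
  drop-0 : ∀ y u → y + (u - + 0) ≡ y + u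
  drop-0 = solve-∀
  shift : ∀ x u t → x + + 2 + (u - (+ 1 + t)) ≡ x + ((+ 1 + u) - t)
  shift = solve-∀

spread-last : ∀ T g x → spread T g x ≡ ∑[ t < T ] g (x + (+ (T ∸ t) - + t)) + g (x - + T)
spread-last T g x = trans (∑-init-last T (λ t → g (x + (+ (T ∸ t) - + t))))
  (cong (_+_ (∑[ t < T ] g (x + (+ (T ∸ t) - + t))))
        (cong g (trans (cong (λ s → x + (+ s - + T)) (ℕP.n∸n≡0 T)) (drop-0 x (+ T)))))
  where
  drop-0 : ∀ x u → x + (+ 0 - u) ≡ x - u
  drop-0 = solve-∀

nonincreasingBy2-iterate : ∀ {g} → NonincreasingBy2 g → ∀ d p → g (+ (d ℕ.* 2 ℕ.+ p)) ≤ g (+ p)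
nonincreasingBy2-iterate     mono zero    p = ℤP.≤-refl
nonincreasingBy2-iterate {g} mono (suc d) p = ℤP.≤-trans
  (subst (λ z → g (+ z) ≤ g (+ (d ℕ.* 2 ℕ.+ p))) (ℕP.+-comm (d ℕ.* 2 ℕ.+ p) 2) (mono (d ℕ.* 2 ℕ.+ p)))
  (nonincreasingBy2-iterate {g} mono d p)

g[p+2+T]≤g[p-T] : ∀ {g} → Symmetric g → NonincreasingBy2 g → ∀ p T → g (+ p + + 2 + + T) ≤ g (+ p - + T)
g[p+2+T]≤g[p-T] {g} sym-g mono p T with ℕP.≤-total T p
... | inj₁ T≤p with ℕP.m≤n⇒∃[o]m+o≡n T≤p
...   | q , refl = subst₂ _≤_ (cong (g ∘ +_) (sym (far T q))) (cong g (sym (near T q)))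
                          (nonincreasingBy2-iterate {g} mono (suc T) q)
  where
  far : ∀ T q → T ℕ.+ q ℕ.+ 2 ℕ.+ T ≡ suc T ℕ.* 2 ℕ.+ q
  far = ℕ-Solver.solve-∀
  cancel : ∀ a b → (a + b) - a ≡ b
  cancel = solve-∀
  near : ∀ T q → + (T ℕ.+ q) - + T ≡ + q
  near T q = trans (cong (_- + T) (ℤP.pos-+ T q)) (cancel (+ T) (+ q))
g[p+2+T]≤g[p-T] {g} sym-g mono p T | inj₂ p≤T with ℕP.m≤n⇒∃[o]m+o≡n p≤T
...   | q , refl = subst₂ _≤_ (cong (g ∘ +_) (sym (far p q))) (trans (sym (sym-g (+ q))) (cong g (sym (near p q))))
                          (nonincreasingBy2-iterate {g} mono (suc p) q)
  where
  far : ∀ p q → p ℕ.+ 2 ℕ.+ (p ℕ.+ q) ≡ suc p ℕ.* 2 ℕ.+ q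
  far = ℕ-Solver.solve-∀
  cancel : ∀ a b → a - (a + b) ≡ - b
  cancel = solve-∀
  near : ∀ p q → + p - + (p ℕ.+ q) ≡ - + q
  near p q = trans (cong (_-_ (+ p)) (ℤP.pos-+ p q)) (cancel (+ p) (+ q))

spread-nonincreasing : ∀ {g} → Symmetric g → NonincreasingBy2 g → ∀ T → NonincreasingBy2 (spread T g)
spread-nonincreasing {g} sym-g mono T p = begin
  spread T g (+ p + + 2)  ≡⟨ spread-head T g (+ p) ⟩
  g (+ p + + 2 + + T) + S ≤⟨ ℤP.+-monoˡ-≤ S (g[p+2+T]≤g[p-T] sym-g mono p T) ⟩
  g (+ p - + T) + S       ≡⟨ ℤP.+-comm (g (+ p - + T)) S ⟩
  S + g (+ p - + T)       ≡⟨ sym (spread-last T g (+ p)) ⟩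
  spread T g (+ p)        ∎
  where
  open ℤP.≤-Reasoning
  S = ∑[ t < T ] g (+ p + (+ (T ∸ t) - + t))

mulQ-supported : ∀ k {f} → (∀ n → Supported n (f n)) → ∀ n → Supported n (mulQ k f n)
mulQ-supported k {f} supp n x n<∣x∣ = ∑-zero (suc n) (λ n₁ n₁≤n →
  atMultiple-zero k (n ∸ n₁) (λ T T≤n-n₁ →
    spread-supported (supp n₁) T x (ℕP.≤-<-trans (n₁+T≤n (ℕP.≤-pred n₁≤n) T≤n-n₁) n<∣x∣)))
  where
  n₁+T≤n : ∀ {n₁ T} → n₁ ℕ.≤ n → T ℕ.≤ n ∸ n₁ → n₁ ℕ.+ T ℕ.≤ n
  n₁+T≤n {n₁} n₁≤n T≤n-n₁ =
    ℕP.≤-trans (ℕP.+-monoʳ-≤ n₁ T≤n-n₁) (ℕP.≤-reflexive (ℕP.m+[n∸m]≡n n₁≤n))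

mulQ-symmetric : ∀ k {f} → (∀ n → Symmetric (f n)) → ∀ n → Symmetric (mulQ k f n)
mulQ-symmetric k sym-f n x =
  ∑-cong (suc n) (λ n₁ _ → atMultiple-cong k (n ∸ n₁) (λ T _ → spread-symmetric (sym-f n₁) T x))

mulQ-nonincreasing : ∀ k {f} → (∀ n → Symmetric (f n)) → (∀ n → NonincreasingBy2 (f n)) →
                     ∀ n → NonincreasingBy2 (mulQ k f n)
mulQ-nonincreasing k sym-f mono-f n p = ∑-mono-≤ (suc n) (λ n₁ _ →
  atMultiple-mono-≤ k (n ∸ n₁) (λ T → spread-nonincreasing (sym-f n₁) (mono-f n₁) T p))

one-supported : ∀ n → Supported n (one n)
one-supported zero    (+ zero)  ()
one-supported zero    (+ suc _) _ = refl
one-supported zero    -[1+ _ ]  _ = refl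
one-supported (suc n) _         _ = refl

one-symmetric : ∀ n → Symmetric (one n)
one-symmetric zero    (+ zero)  = refl
one-symmetric zero    (+ suc _) = refl
one-symmetric zero    -[1+ _ ]  = refl
one-symmetric (suc n) _         = refl

one-nonincreasing : ∀ n → NonincreasingBy2 (one n)
one-nonincreasing zero    zero    = ℤ.+≤+ z≤n
one-nonincreasing zero    (suc p) = ℤP.≤-refl
one-nonincreasing (suc n) p       = ℤP.≤-refl

F-supported : ∀ k n → Supported n (F k n)
F-supported zero    = one-supported
F-supported (suc k) n x n<∣x∣ =
  trans (⊛-Q k (F k) (F-supported k) n x) (mulQ-supported k (F-supported k) n x n<∣x∣)

F-suc : ∀ k n m → F (suc k) n m ≡ mulQ k (F k) n m
F-suc k = ⊛-Q k (F k) (F-supported k)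

F-symmetric : ∀ k n → Symmetric (F k n)
F-symmetric zero        = one-symmetric
F-symmetric (suc k) n x = begin
  F (suc k) n (- x)    ≡⟨ F-suc k n (- x) ⟩
  mulQ k (F k) n (- x) ≡⟨ mulQ-symmetric k (F-symmetric k) n x ⟩
  mulQ k (F k) n x     ≡⟨ sym (F-suc k n x) ⟩
  F (suc k) n x        ∎
  where open ≡-Reasoning

F-nonincreasing : ∀ k n → NonincreasingBy2 (F k n)
F-nonincreasing zero        = one-nonincreasing
F-nonincreasing (suc k) n p = subst₂ _≤_ (sym (F-suc k n (+ p + + 2))) (sym (F-suc k n (+ p)))
  (mulQ-nonincreasing k (F-symmetric k) (F-nonincreasing k) n p)

lemma4p1 : (k m n : ℕ) → a k (+ m + + 2) n ≤ a k (+ m) n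
lemma4p1 k m n = F-nonincreasing k n m
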